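{- Let $n\geq 5$ and let $G$ be a graph on $n$ vertices such that both $G$ and its complement $\overline{G}$ are connected. Then $rvc(G)+rvc(\overline{G})\leq n-1$. Moreover, this bound is best possible: for every $n\geq 5$ there is a graph $G$ on $n$ vertices with $G$ and $\overline{G}$ both connected and $rvc(G)+rvc(\overline{G})=n-1$.
   Context: All graphs are finite, simple and undirected. A vertex-coloring of a graph (not necessarily proper) makes the graph rainbow vertex-connected if every pair of distinct vertices is joined by a path whose internal vertices have pairwise distinct colors. For a connected graph $G$, the rainbow vertex-connection number $rvc(G)$ is the minimum number of colors in a vertex-coloring making $G$ rainbow vertex-connected (so $rvc(G)=0$ exactly when $G$ is complete). $\overline{G}$ denotes the complement of $G$. -}

module Defs where

open import Data.Nat using (ℕ; _<_)
open import Data.Fin using (Fin)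
open import Data.Bool using (Bool; true; false; not; _∧_)
open import Data.List using (List; []; _∷_; map; _++_)
open import Data.List.Relation.Unary.Unique.Propositional using (Unique)
open import Data.Product using (Σ; _×_; ∃; ∃-syntax; _,_)
open import Relation.Binary.PropositionalEquality using (_≡_; _≢_)
open import Relation.Nullary using (¬_; does)
open import Data.Fin using (_≟_)

record Graph (n : ℕ) : Set where
  field
    adj   : Fin n → Fin n → Bool
    adj-sym : ∀ x y → adj x y ≡ adj y x
    irrefl : ∀ x → adj x x ≡ false

open Graph public using (adj)

complement : ∀ {n} → Graph n → Graph n
complement {n} G = record
  { adj = λ x y → not (does (x ≟ y)) ∧ not (adj G x y)
  ; adj-sym = symP
  ; irrefl = irr
  }
  where
  open import Relation.Binary.PropositionalEquality using (refl; sym; cong₂; cong)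
  open import Relation.Nullary using (yes; no)
  symP : ∀ x y → not (does (x ≟ y)) ∧ not (adj G x y) ≡ not (does (y ≟ x)) ∧ not (adj G y x)
  symP x y with x ≟ y | y ≟ x
  ... | yes _ | yes _ = refl
  ... | yes p | no q = Data.Empty.⊥-elim (q (sym p)) where import Data.Empty
  ... | no q | yes p = Data.Empty.⊥-elim (q (sym p)) where import Data.Empty
  ... | no _ | no _ = cong not (Graph.adj-sym G x y)
  irr : ∀ x → not (does (x ≟ x)) ∧ not (adj G x x) ≡ false
  irr x with x ≟ x
  ... | yes _ = refl
  ... | no q = Data.Empty.⊥-elim (q refl) where import Data.Empty

data Walk {n : ℕ} (G : Graph n) : List (Fin n) → Set where
  single : ∀ x → Walk G (x ∷ [])
  step   : ∀ x y vs → adj G x y ≡ true → Walk G (y ∷ vs) → Walk G (x ∷ y ∷ vs)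

-- A path from u to v with internal vertex list ws: u ∷ ws ++ [v] is a walk
-- with pairwise distinct vertices.
IsPath : ∀ {n} → Graph n → Fin n → List (Fin n) → Fin n → Set
IsPath G u ws v = Walk G (u ∷ ws ++ (v ∷ [])) × Unique (u ∷ ws ++ (v ∷ []))

Connected : ∀ {n} → Graph n → Set
Connected G = ∀ u v → u ≢ v → ∃[ ws ] IsPath G u ws v

-- vertex-coloring with (at most) k colors, not necessarily proper
Coloring : ℕ → ℕ → Set
Coloring n k = Fin n → Fin k

RainbowVConnected : ∀ {n k} → Graph n → Coloring n k → Set
RainbowVConnected G c =
  ∀ u v → u ≢ v → ∃[ ws ] (IsPath G u ws v × Unique (map c ws))

IsRVC : ∀ {n} → Graph n → ℕ → Set
IsRVC {n} G k =
  (Σ (Coloring n k) (RainbowVConnected G)) ×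
  (∀ j → j < k → ¬ Σ (Coloring n j) (RainbowVConnected G))

-- Two vertices a, b at distance at least 3 in H have no common neighbour, so in the complement of H
-- every vertex is adjacent to a or b, and coloring a and b differently makes it rainbow connected.
-- A graph of diameter at most 2 is rainbow connected with one color. A connected graph on n ≥ 3
-- vertices has rvc ≤ n − 2: grow a connected vertex set C with two vertices s ≠ t outside it, both
-- adjacent to C, absorbing s (or t) into C while it has a neighbour outside C ∪ {s, t}. At the end
-- every other vertex reaches C while avoiding s and t, so V − {s, t} is a connected dominating set,
-- and any coloring injective on it is rainbow. Hence the sum is at most 2 + 2 ≤ n − 1 when neither G
-- nor its complement has diameter at most 2, and at most 1 + (n − 2) otherwise. On the path P_n every
-- inner vertex separates the two ends, so rvc(P_n) = n − 2, while for n ≥ 5 its complement has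
-- diameter 2 and rvc 1.

module Submission where

open import Defs
open import Data.Bool using (true; false; if_then_else_)
import Data.Bool.Properties as Boolₚ
open import Data.Empty using (⊥; ⊥-elim)
open import Data.Fin using (Fin; zero; suc; _≟_; toℕ; punchOut; fromℕ; fromℕ<; inject₁)
import Data.Fin.Properties as Finₚ
open import Data.Fin.Properties
  using ( any?; injective⇒≤; punchOut-injective; toℕ-injective; toℕ<n; toℕ-fromℕ; toℕ-fromℕ<
        ; toℕ-inject₁-≢; inject₁-injective )
open import Data.List using (List; []; _∷_; [_]; _++_; map; length; lookup)
open import Data.List.Membership.Propositional using (_∈_; _∉_)
open import Data.List.Membership.Propositional.Properties using (∈-++⁻; ∈-++⁺ˡ; ∈-map⁺; ∈-lookup)
open import Data.List.Relation.Binary.Permutation.Propositional using (↭-refl; ↭-swap)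
open import Data.List.Relation.Binary.Permutation.Propositional.Properties using (∈-resp-↭)
open import Data.List.Relation.Binary.Subset.Propositional using (_⊆_)
open import Data.List.Relation.Binary.Subset.Propositional.Properties using (∷⁺ʳ; ∈-∷⁺ʳ)
open import Data.List.Relation.Unary.All as All using (All; []; _∷_)
open import Data.List.Relation.Unary.All.Properties using (¬Any⇒All¬; anti-mono; ++⁺; ++⁻ʳ)
import Data.List.Relation.Unary.All.Properties as Allₚ
open import Data.List.Relation.Unary.AllPairs using ([]; _∷_)
open import Data.List.Relation.Unary.Any using (here; there)
open import Data.List.Relation.Unary.Unique.Propositional using (Unique)
open import Data.Nat using (ℕ; zero; suc; _≤_; _<_; _+_; _∸_; z≤n; s≤s; ∣_-_∣; _≡ᵇ_)
import Data.Nat.Properties as ℕₚ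
open import Data.Product using (Σ; _×_; ∃; ∃₂; _,_; proj₁; proj₂)
open import Data.Sum using (_⊎_; inj₁; inj₂)
open import Function using (_∘_; id)
open import Function.Bundles using (Equivalence)
open import Function.Definitions using (Injective)
open import Relation.Binary.PropositionalEquality using (_≡_; _≢_; refl; sym; trans; cong; cong₂; subst)
open import Relation.Nullary using (¬_; yes; no; Dec; does)
open import Relation.Nullary.Decidable using (dec-true; dec-false; ¬?; _×-dec_)
open import Relation.Unary using (Decidable; ∁)

Edge : ∀ {n} → Graph n → Fin n → Fin n → Set
Edge G x y = adj G x y ≡ true

_ᶜ⊆_ : ∀ {n} → Graph n → Graph n → Set
H ᶜ⊆ K = ∀ {x y} → x ≢ y → adj H x y ≡ false → Edge K x y

ᶜ⊆-complement : ∀ {n} (G : Graph n) → G ᶜ⊆ complement G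
ᶜ⊆-complement G {x} {y} x≢y nonedge rewrite dec-false (x ≟ y) x≢y | nonedge = refl

complement-ᶜ⊆ : ∀ {n} (G : Graph n) → complement G ᶜ⊆ G
complement-ᶜ⊆ G {x} {y} x≢y nonedge rewrite dec-false (x ≟ y) x≢y = Boolₚ.not-injective nonedge

InjectiveOn : ∀ {A B : Set} → (A → Set) → (A → B) → Set
InjectiveOn W f = ∀ {x y} → W x → W y → f x ≡ f y → x ≡ y

Unique-map⁺ : ∀ {A B : Set} {W : A → Set} {f : A → B} {xs} →
              InjectiveOn W f → All W xs → Unique xs → Unique (map f xs)
Unique-map⁺ inj [] [] = []
Unique-map⁺ {f = f} inj (wx ∷ wxs) (x∉ ∷ uniq) =
  Allₚ.map⁺ (All.zipWith (λ (x≢y , wy) fx≡fy → x≢y (inj wx wy fx≡fy)) (x∉ , wxs))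
  ∷ Unique-map⁺ inj wxs uniq

Unique-map⇒injective-∈ : ∀ {A B : Set} (f : A → B) {xs} → Unique (map f xs) →
                          ∀ {x y} → x ∈ xs → y ∈ xs → f x ≡ f y → x ≡ y
Unique-map⇒injective-∈ f (_ ∷ _) (here refl) (here refl) _ = refl
Unique-map⇒injective-∈ f (fx∉ ∷ _) (here refl) (there y∈) fx≡fy =
  ⊥-elim (All.lookup fx∉ (∈-map⁺ f y∈) fx≡fy)
Unique-map⇒injective-∈ f (fy∉ ∷ _) (there x∈) (here refl) fx≡fy =
  ⊥-elim (All.lookup fy∉ (∈-map⁺ f x∈) (sym fx≡fy))
Unique-map⇒injective-∈ f (_ ∷ uniq) (there x∈) (there y∈) = Unique-map⇒injective-∈ f uniq x∈ y∈

Unique-∷ʳ⁻ : ∀ {A : Set} xs {v : A} → Unique (xs ++ [ v ]) → Unique xs × All (_≢ v) xs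
Unique-∷ʳ⁻ [] _ = [] , []
Unique-∷ʳ⁻ (x ∷ xs) (x∉ ∷ uniq) with Unique-∷ʳ⁻ xs uniq
... | uniq′ , xs≢v = Allₚ.++⁻ˡ xs x∉ ∷ uniq′ , All.head (++⁻ʳ xs x∉) ∷ xs≢v

lookup-injective : ∀ {A : Set} {xs : List A} → Unique xs → Injective _≡_ _≡_ (lookup xs)
lookup-injective {xs = _ ∷ _} _ {zero} {zero} _ = refl
lookup-injective {xs = _ ∷ xs} (x∉ ∷ _) {zero} {suc j} eq = ⊥-elim (All.lookup x∉ (∈-lookup j) eq)
lookup-injective {xs = _ ∷ xs} (x∉ ∷ _) {suc i} {zero} eq = ⊥-elim (All.lookup x∉ (∈-lookup i) (sym eq))
lookup-injective {xs = _ ∷ xs} (_ ∷ uniq) {suc i} {suc j} eq = cong suc (lookup-injective uniq eq)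

Unique⇒length≤ : ∀ {n} {xs : List (Fin n)} → Unique xs → length xs ≤ n
Unique⇒length≤ uniq = injective⇒≤ (lookup-injective uniq)

module Routes {n : ℕ} (G : Graph n) where

  open import Data.List.Membership.DecPropositional (_≟_ {n}) using (_∈?_)

  edge-sym : ∀ {x y} → Edge G x y → Edge G y x
  edge-sym {x} {y} e = trans (Graph.adj-sym G y x) e

  edge⇒≢ : ∀ {x y} → Edge G x y → x ≢ y
  edge⇒≢ {x} e refl with trans (sym e) (Graph.irrefl G x)
  ... | ()

  data Route : Fin n → Fin n → List (Fin n) → Set where
    stay : ∀ {u} → Route u u []
    move : ∀ {u y v xs} → Edge G u y → Route y v xs → Route u v (y ∷ xs)

  _++ᴿ_ : ∀ {u v w xs ys} → Route u v xs → Route v w ys → Route u w (xs ++ ys)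
  stay     ++ᴿ r = r
  move e p ++ᴿ r = move e (p ++ᴿ r)

  end∈ : ∀ {u v xs} → Route u v xs → v ∈ u ∷ xs
  end∈ stay       = here refl
  end∈ (move _ r) = there (end∈ r)

  reverseᴿ : ∀ {u v xs} → Route u v xs → ∃ λ ys → Route v u ys × ys ⊆ u ∷ xs
  reverseᴿ stay = [] , stay , λ ()
  reverseᴿ {u} (move e r) with reverseᴿ r
  ... | ys , r′ , ys⊆ = ys ++ [ u ] , r′ ++ᴿ move (edge-sym e) stay , back ∘ ∈-++⁻ ys
    where
    back : ∀ {x} → x ∈ ys ⊎ x ∈ [ u ] → x ∈ u ∷ _
    back (inj₁ x∈ys)      = there (ys⊆ x∈ys)
    back (inj₂ (here refl)) = here refl

  drop-to : ∀ {u v xs z} → Route u v xs → z ∈ u ∷ xs →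
            ∃ λ zs → Route z v zs × zs ⊆ xs × (Unique (u ∷ xs) → Unique (z ∷ zs))
  drop-to r          (here refl) = _ , r , id , id
  drop-to (move _ r) (there z∈)  with drop-to r z∈
  ... | zs , r′ , zs⊆ , unique⇒ = zs , r′ , there ∘ zs⊆ , λ { (_ ∷ uniq) → unique⇒ uniq }

  shortcut : ∀ {u v xs} → Route u v xs → ∃ λ ys → Route u v ys × Unique (u ∷ ys) × ys ⊆ xs
  shortcut stay = [] , stay , [] ∷ [] , id
  shortcut {u} (move {y = y} e r) with shortcut r
  ... | ys , r′ , uniq , ys⊆ with u ∈? (y ∷ ys)
  ...   | yes u∈ = let zs , r″ , zs⊆ , unique⇒ = drop-to r′ u∈
                   in zs , r″ , unique⇒ uniq , there ∘ ys⊆ ∘ zs⊆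
  ...   | no u∉  = y ∷ ys , move e r′ , ¬Any⇒All¬ _ u∉ ∷ uniq , ∷⁺ʳ y ys⊆

  route-snoc : ∀ {u v xs} → Route u v xs → ∃ λ ws → u ∷ xs ≡ ws ++ [ v ]
  route-snoc stay = [] , refl
  route-snoc {u} (move _ r) with route-snoc r
  ... | ws , eq = u ∷ ws , cong (u ∷_) eq

  route-ends : ∀ {u v xs} → Route u v xs → u ≢ v → ∃ λ ws → xs ≡ ws ++ [ v ]
  route-ends r u≢v with route-snoc r
  ... | []     , refl = ⊥-elim (u≢v refl)
  ... | _ ∷ ws , refl = ws , refl

  route⇒walk : ∀ {u v xs} → Route u v xs → Walk G (u ∷ xs)
  route⇒walk stay       = single _
  route⇒walk (move e r) = step _ _ _ e (route⇒walk r)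

  walk⇒route : ∀ {u v} ws → Walk G (u ∷ ws ++ [ v ]) → Route u v (ws ++ [ v ])
  walk⇒route []       (step _ _ _ e (single _)) = move e stay
  walk⇒route (_ ∷ ws) (step _ _ _ e walk)       = move e (walk⇒route ws walk)

  route⇒path : ∀ {u v xs} → Route u v xs → u ≢ v → ∃ λ ws → IsPath G u ws v × ws ⊆ xs
  route⇒path r u≢v with shortcut r
  ... | ys , r′ , uniq , ys⊆ with route-ends r′ u≢v
  ...   | ws , refl = ws , (route⇒walk r′ , uniq) , ys⊆ ∘ ∈-++⁺ˡ

  routes⇒connected : (∀ u v → ∃ (Route u v)) → Connected G
  routes⇒connected route u v u≢v with route⇒path (proj₂ (route u v)) u≢v
  ... | ws , path , _ = ws , path

  connected⇒route : Connected G → ∀ u v → ∃ (Route u v)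
  connected⇒route connected u v with u ≟ v
  ... | yes refl = [] , stay
  ... | no u≢v with connected u v u≢v
  ...   | ws , walk , _ = ws ++ [ v ] , walk⇒route ws walk

  first-entry : ∀ {P : Fin n → Set} → Decidable P → ∀ {u v xs} → Route u v xs → P v →
                P u ⊎ ∃₂ λ w z → ∃ λ ws → Route u w ws × All (∁ P) (u ∷ ws) × Edge G w z × P z
  first-entry P? {u} r Pv with P? u
  ... | yes Pu = inj₁ Pu
  first-entry P? stay       Pv | no ¬Pu = ⊥-elim (¬Pu Pv)
  first-entry P? (move e r) Pv | no ¬Pu with first-entry P? r Pv
  ... | inj₁ Py = inj₂ (_ , _ , [] , stay , ¬Pu ∷ [] , e , Py)
  ... | inj₂ (w , z , ws , r′ , outside , e′ , Pz) =
    inj₂ (w , z , _ , move e r′ , ¬Pu ∷ outside , e′ , Pz)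

  Diameter≤2 : Set
  Diameter≤2 = ∀ {a b} → a ≢ b → adj G a b ≡ false → ∃ λ x → Edge G a x × Edge G x b

  diameter≤2⇒rainbow : Diameter≤2 → ∀ {k} (c : Coloring n k) → RainbowVConnected G c
  diameter≤2⇒rainbow diam c u v u≢v with adj G u v in uv
  ... | true  = [] , (route⇒walk (move uv stay) , (u≢v ∷ []) ∷ [] ∷ []) , []
  ... | false with diam u≢v uv
  ...   | x , ux , xv =
    [ x ] , (route⇒walk (move ux (move xv stay)) , (edge⇒≢ ux ∷ u≢v ∷ []) ∷ (edge⇒≢ xv ∷ []) ∷ [] ∷ []) ,
    [] ∷ []

  Dominating : (Fin n → Set) → Set
  Dominating W = ∀ x → W x ⊎ ∃ λ y → W y × Edge G x y

  ConnectedWithin : (Fin n → Set) → Set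
  ConnectedWithin W = ∀ {x y} → W x → W y → ∃ λ xs → Route x y xs × All W xs

  module _ {W : Fin n → Set} {k} {c : Coloring n k} (injective : InjectiveOn W c) where

    route⇒rainbow-path : ∀ {u v xs} → Route u v xs → All (λ x → W x ⊎ x ≡ v) xs → u ≢ v →
                         ∃ λ ws → IsPath G u ws v × Unique (map c ws)
    route⇒rainbow-path {v = v} r inside u≢v with route⇒path r u≢v
    ... | ws , path@(_ , _ ∷ uniq) , ws⊆ with Unique-∷ʳ⁻ ws uniq
    ...   | uniq-ws , ws≢v =
      ws , path , Unique-map⁺ injective (All.zipWith inW (anti-mono ws⊆ inside , ws≢v)) uniq-ws
      where
      inW : ∀ {x} → (W x ⊎ x ≡ v) × x ≢ v → W x
      inW (inj₁ Wx   , _)   = Wx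
      inW (inj₂ x≡v , x≢v) = ⊥-elim (x≢v x≡v)

    connected-dominating⇒rainbow : Dominating W → ConnectedWithin W → RainbowVConnected G c
    connected-dominating⇒rainbow dominating connected u v u≢v =
      let a , Wa , xs , u⇝a , xs∈W = enter u
          b , Wb , zs , b⇝v , zs∈  = leave v
          ys , a⇝b , ys∈W          = connected Wa Wb
      in route⇒rainbow-path (u⇝a ++ᴿ (a⇝b ++ᴿ b⇝v))
                            (++⁺ (All.map inj₁ xs∈W) (++⁺ (All.map inj₁ ys∈W) zs∈)) u≢v
      where
      enter : ∀ u → ∃ λ a → W a × ∃ λ xs → Route u a xs × All W xs
      enter u with dominating u
      ... | inj₁ Wu             = u , Wu , [] , stay , []
      ... | inj₂ (a , Wa , ua) = a , Wa , [ a ] , move ua stay , Wa ∷ []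
      leave : ∀ v → ∃ λ b → W b × ∃ λ zs → Route b v zs × All (λ x → W x ⊎ x ≡ v) zs
      leave v with dominating v
      ... | inj₁ Wv             = v , Wv , [] , stay , []
      ... | inj₂ (b , Wb , vb) = b , Wb , [ v ] , move (edge-sym vb) stay , inj₂ refl ∷ []

IsRVC⇒≤ : ∀ {n} {H : Graph n} {r j} → IsRVC H r → Σ (Coloring n j) (RainbowVConnected H) → r ≤ j
IsRVC⇒≤ (_ , minimal) coloring = ℕₚ.≮⇒≥ (λ j<r → minimal _ j<r coloring)

rainbow⇒connected : ∀ {n k} {H : Graph n} {c : Coloring n k} → RainbowVConnected H c → Connected H
rainbow⇒connected rainbow u v u≢v with rainbow u v u≢v
... | ws , path , _ = ws , path

-- A rainbow u–v path meets every vertex f i, so the colors of the f i are pairwise distinct.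
cut⇒colors≥ : ∀ {n k j} (H : Graph n) {u v} → u ≢ v →
              (f : Fin k → Fin n) → Injective _≡_ _≡_ f →
              (∀ {ws} → IsPath H u ws v → ∀ i → f i ∈ ws) →
              Σ (Coloring n j) (RainbowVConnected H) → k ≤ j
cut⇒colors≥ H u≢v f f-injective through (c , rainbow) with rainbow _ _ u≢v
... | ws , path , distinct = injective⇒≤ λ {i} {i′} eq →
  f-injective (Unique-map⇒injective-∈ c distinct (through path i) (through path i′) eq)

common-neighbour? : ∀ {n} (H : Graph n) a b → Dec (∃ λ x → Edge H a x × Edge H x b)
common-neighbour? H a b = any? λ x → (adj H a x Boolₚ.≟ true) ×-dec (adj H x b Boolₚ.≟ true)

Distance≥3 : ∀ {n} → Graph n → Fin n → Fin n → Set
Distance≥3 H a b = a ≢ b × adj H a b ≡ false × ¬ (∃ λ x → Edge H a x × Edge H x b)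

distance≥3? : ∀ {n} (H : Graph n) → Dec (∃₂ (Distance≥3 H))
distance≥3? H = any? λ a → any? λ b →
  ¬? (a ≟ b) ×-dec (adj H a b Boolₚ.≟ false) ×-dec ¬? (common-neighbour? H a b)

¬distance≥3⇒diameter≤2 : ∀ {n} (H : Graph n) → ¬ ∃₂ (Distance≥3 H) → Routes.Diameter≤2 H
¬distance≥3⇒diameter≤2 H none {a} {b} a≢b nonedge with common-neighbour? H a b
... | yes common  = common
... | no ¬common = ⊥-elim (none (a , b , a≢b , nonedge , ¬common))

¬distance≥3⇒rainbow₁ : ∀ {n} (H : Graph n) → ¬ ∃₂ (Distance≥3 H) →
                       Σ (Coloring n 1) (RainbowVConnected H)
¬distance≥3⇒rainbow₁ H none =
  (λ _ → zero) , Routes.diameter≤2⇒rainbow H (¬distance≥3⇒diameter≤2 H none) _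

-- No vertex is adjacent in H to both a and b, so in K it is adjacent to one of them.
distance≥3⇒rainbow₂ : ∀ {n} (H K : Graph n) → H ᶜ⊆ K → ∀ {a b} → Distance≥3 H a b →
                       Σ (Coloring n 2) (RainbowVConnected K)
distance≥3⇒rainbow₂ {n} H K H⊆K {a} {b} (a≢b , ab , no-common) =
  c , connected-dominating⇒rainbow injective dominating connected
  where
  open Routes K
  W : Fin n → Set
  W x = x ≡ a ⊎ x ≡ b
  c : Coloring n 2
  c x = if does (x ≟ a) then zero else suc zero
  ca≢cb : c a ≢ c b
  ca≢cb rewrite dec-true (a ≟ a) refl | dec-false (b ≟ a) (a≢b ∘ sym) = λ ()
  injective : InjectiveOn W c
  injective (inj₁ refl) (inj₁ refl) _  = refl
  injective (inj₂ refl) (inj₂ refl) _  = refl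
  injective (inj₁ refl) (inj₂ refl) eq = ⊥-elim (ca≢cb eq)
  injective (inj₂ refl) (inj₁ refl) eq = ⊥-elim (ca≢cb (sym eq))
  dominating : Dominating W
  dominating x with x ≟ a | x ≟ b
  ... | yes x≡a | _       = inj₁ (inj₁ x≡a)
  ... | no _    | yes x≡b = inj₁ (inj₂ x≡b)
  ... | no x≢a  | no x≢b with adj H x a in xa | adj H x b in xb
  ...   | false | _     = inj₂ (a , inj₁ refl , H⊆K x≢a xa)
  ...   | true  | false = inj₂ (b , inj₂ refl , H⊆K x≢b xb)
  ...   | true  | true  = ⊥-elim (no-common (x , Routes.edge-sym H xa , xb))
  connected : ConnectedWithin W
  connected (inj₁ refl) (inj₁ refl) = [] , stay , []
  connected (inj₂ refl) (inj₂ refl) = [] , stay , []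
  connected (inj₁ refl) (inj₂ refl) = [ b ] , move (H⊆K a≢b ab) stay , inj₂ refl ∷ []
  connected (inj₂ refl) (inj₁ refl) = [ a ] , move (edge-sym (H⊆K a≢b ab)) stay , inj₁ refl ∷ []

-- Punch out s, then the image of t; the values at s and t themselves are irrelevant.
squash : ∀ {m} {s t : Fin (suc (suc (suc m)))} → s ≢ t → Fin (suc (suc (suc m))) → Fin (suc m)
squash {s = s} s≢t x with s ≟ x
... | yes _   = zero
... | no s≢x with punchOut s≢t ≟ punchOut s≢x
...   | yes _   = zero
...   | no t≢x = punchOut t≢x

squash-injective : ∀ {m} {s t : Fin (suc (suc (suc m)))} (s≢t : s ≢ t) →
                   InjectiveOn (λ x → x ≢ s × x ≢ t) (squash s≢t)
squash-injective {s = s} s≢t {x} {y} (x≢s , x≢t) (y≢s , y≢t) eq with s ≟ x | s ≟ y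
... | yes s≡x | _       = ⊥-elim (x≢s (sym s≡x))
... | no _    | yes s≡y = ⊥-elim (y≢s (sym s≡y))
... | no s≢x  | no s≢y with punchOut s≢t ≟ punchOut s≢x | punchOut s≢t ≟ punchOut s≢y
...   | yes tx | _      = ⊥-elim (x≢t (sym (punchOut-injective s≢t s≢x tx)))
...   | no _   | yes ty = ⊥-elim (y≢t (sym (punchOut-injective s≢t s≢y ty)))
...   | no t≢x | no t≢y = punchOut-injective s≢x s≢y (punchOut-injective t≢x t≢y eq)

module Cores {m : ℕ} (G : Graph (suc (suc (suc m)))) (connected : Connected G) where

  open Routes G
  open import Data.List.Membership.DecPropositional (_≟_ {suc (suc (suc m))}) using (_∈?_)

  private
    N : ℕ
    N = suc (suc (suc m))
    V : Set
    V = Fin N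

  record Core : Set where
    field
      s t hub        : V
      members        : List V
      s≢t            : s ≢ t
      s∉members      : s ∉ members
      t∉members      : t ∉ members
      members-unique : Unique members
      s-anchor       : ∃ λ a → a ∈ members × Edge G s a
      t-anchor       : ∃ λ b → b ∈ members × Edge G t b
      linked         : ∀ {z} → z ∈ members → ∃ λ zs → Route z hub zs × zs ⊆ members

    vertices : List V
    vertices = s ∷ t ∷ members

  flip : Core → Core
  flip c = record
    { s = t ; t = s ; hub = hub ; members = members ; s≢t = s≢t ∘ sym
    ; s∉members = t∉members ; t∉members = s∉members ; members-unique = members-unique
    ; s-anchor = t-anchor ; t-anchor = s-anchor ; linked = linked }
    where open Core c

  absorb : (c : Core) → ∀ {z} → Edge G (Core.s c) z → z ∉ Core.vertices c → Core
  absorb c {z} sz z∉ = record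
    { s = z ; t = t ; hub = hub ; members = s ∷ members
    ; s≢t = z∉ ∘ there ∘ here
    ; s∉members = λ { (here z≡s) → z∉ (here z≡s) ; (there z∈) → z∉ (there (there z∈)) }
    ; t∉members = λ { (here t≡s) → s≢t (sym t≡s) ; (there t∈) → t∉members t∈ }
    ; members-unique = ¬Any⇒All¬ _ s∉members ∷ members-unique
    ; s-anchor = s , here refl , edge-sym sz
    ; t-anchor = let b , b∈ , tb = t-anchor in b , there b∈ , tb
    ; linked = λ
      { (here refl) → let a , a∈ , sa = s-anchor ; zs , a⇝hub , zs⊆ = linked a∈
                      in a ∷ zs , move sa a⇝hub , ∈-∷⁺ʳ (there a∈) (there ∘ zs⊆)
      ; (there z∈) → let zs , z⇝hub , zs⊆ = linked z∈ in zs , z⇝hub , there ∘ zs⊆ }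
    }
    where open Core c

  three-path⇒core : ∀ {u a v} → Edge G u a → Edge G a v → u ≢ a → u ≢ v → a ≢ v → Core
  three-path⇒core {u} {a} {v} ua av u≢a u≢v a≢v = record
    { s = u ; t = v ; hub = a ; members = [ a ] ; s≢t = u≢v
    ; s∉members = λ { (here u≡a) → u≢a u≡a } ; t∉members = λ { (here v≡a) → a≢v (sym v≡a) }
    ; members-unique = [] ∷ []
    ; s-anchor = a , here refl , ua ; t-anchor = a , here refl , edge-sym av
    ; linked = λ { (here refl) → [] , stay , λ () } }

  path⇒core : ∀ {u v} a ws → IsPath G u (a ∷ ws) v → Core
  path⇒core a [] (step _ _ _ ua (step _ _ _ av _) , (u≢a ∷ u≢v ∷ []) ∷ (a≢v ∷ []) ∷ _) =
    three-path⇒core ua av u≢a u≢v a≢v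
  path⇒core a (b ∷ _) (step _ _ _ ua (step _ _ _ ab _) , (u≢a ∷ u≢b ∷ _) ∷ (a≢b ∷ _) ∷ _) =
    three-path⇒core ua ab u≢a u≢b a≢b

  initial : Core
  initial with connected zero (suc zero) (λ ())
  ... | a ∷ ws , path = path⇒core a ws path
  ... | [] , (step _ _ _ e₀₁ _ , _) with connected (suc (suc zero)) zero (λ ())
  ...   | a ∷ ws , path                 = path⇒core a ws path
  ...   | [] , (step _ _ _ e₂₀ _ , _) =
    three-path⇒core (edge-sym e₀₁) (edge-sym e₂₀) (λ ()) (λ ()) (λ ())

  Saturated : Core → Set
  Saturated c = ∀ {z} → Edge G (Core.s c) z → z ∈ Core.vertices c

  Maximal : Core → Set
  Maximal c = Saturated c × Saturated (flip c)

  new-neighbour? : (c : Core) → Dec (∃ λ z → Edge G (Core.s c) z × z ∉ Core.vertices c)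
  new-neighbour? c = any? λ z → (adj G (Core.s c) z Boolₚ.≟ true) ×-dec ¬? (z ∈? Core.vertices c)

  ¬new-neighbour⇒saturated : ∀ c → ¬ (∃ λ z → Edge G (Core.s c) z × z ∉ Core.vertices c) →
                             Saturated c
  ¬new-neighbour⇒saturated c none {z} sz with z ∈? Core.vertices c
  ... | yes z∈ = z∈
  ... | no z∉  = ⊥-elim (none (z , sz , z∉))

  core-size : (c : Core) → suc (suc (length (Core.members c))) ≤ N
  core-size c =
    Unique⇒length≤ ((s≢t ∷ ¬Any⇒All¬ _ s∉members) ∷ ¬Any⇒All¬ _ t∉members ∷ members-unique)
    where open Core c

  -- Each absorption adds a member and a core has at most N ∸ 2 members, so N rounds suffice.
  grow : ∀ fuel (c : Core) → N ≤ fuel + length (Core.members c) → Σ Core Maximal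
  grow zero c room =
    ⊥-elim (ℕₚ.1+n≰n (ℕₚ.≤-trans (ℕₚ.n≤1+n _) (ℕₚ.≤-trans (core-size c) room)))
  grow (suc fuel) c room with new-neighbour? c
  ... | yes (z , sz , z∉) = grow fuel (absorb c sz z∉) (subst (N ≤_) (sym (ℕₚ.+-suc fuel _)) room)
  ... | no none-s with new-neighbour? (flip c)
  ...   | yes (z , tz , z∉) = grow fuel (absorb (flip c) tz z∉) (subst (N ≤_) (sym (ℕₚ.+-suc fuel _)) room)
  ...   | no none-t = c , ¬new-neighbour⇒saturated c none-s , ¬new-neighbour⇒saturated (flip c) none-t

  module _ (c : Core) (maximal : Maximal c) where

    open Core c

    Inner : V → Set
    Inner x = x ≢ s × x ≢ t

    member⇒inner : ∀ {x} → x ∈ members → Inner x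
    member⇒inner x∈ = (λ { refl → s∉members x∈ }) , (λ { refl → t∉members x∈ })

    outside⇒inner : ∀ {x} → x ∉ vertices → Inner x
    outside⇒inner x∉ = x∉ ∘ here , x∉ ∘ there ∘ here

    inner-dominating : Dominating Inner
    inner-dominating x with x ≟ s | x ≟ t
    ... | yes refl | _        = let a , a∈ , sa = s-anchor in inj₂ (a , member⇒inner a∈ , sa)
    ... | no _     | yes refl = let b , b∈ , tb = t-anchor in inj₂ (b , member⇒inner b∈ , tb)
    ... | no x≢s   | no x≢t   = inj₁ (x≢s , x≢t)

    member-to-hub : ∀ {z} → z ∈ members → ∃ λ zs → Route z hub zs × All Inner zs
    member-to-hub z∈ =
      let zs , z⇝hub , zs⊆ = linked z∈ in zs , z⇝hub , All.tabulate (member⇒inner ∘ zs⊆)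

    -- On a route from x to s, the vertex before the first core vertex z is outside the core,
    -- so by maximality z is neither s nor t.
    inner-to-hub : ∀ {x} → Inner x → ∃ λ zs → Route x hub zs × All Inner zs
    inner-to-hub {x} (x≢s , x≢t)
      with first-entry (_∈? vertices) (proj₂ (connected⇒route connected x s)) (here refl)
    ... | inj₁ (here x≡s)          = ⊥-elim (x≢s x≡s)
    ... | inj₁ (there (here x≡t))  = ⊥-elim (x≢t x≡t)
    ... | inj₁ (there (there x∈))  = member-to-hub x∈
    ... | inj₂ (w , z , ws , x⇝w , outside , wz , z∈) with z∈
    ...   | here refl          = ⊥-elim (All.lookup outside (end∈ x⇝w) (proj₁ maximal (edge-sym wz)))
    ...   | there (here refl)  = ⊥-elim (All.lookup outside (end∈ x⇝w)
                                   (∈-resp-↭ (↭-swap t s ↭-refl) (proj₂ maximal (edge-sym wz))))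
    ...   | there (there z∈′) =
      let zs , z⇝hub , zs-inner = member-to-hub z∈′
      in ws ++ z ∷ zs , x⇝w ++ᴿ move wz z⇝hub ,
         ++⁺ (All.map outside⇒inner (All.tail outside)) (member⇒inner z∈′ ∷ zs-inner)

    inner-connected : ConnectedWithin Inner
    inner-connected x-inner y-inner =
      let xs , x⇝hub , xs-inner = inner-to-hub x-inner
          ys , y⇝hub , ys-inner = inner-to-hub y-inner
          ys′ , hub⇝y , ys′⊆    = reverseᴿ y⇝hub
      in xs ++ ys′ , x⇝hub ++ᴿ hub⇝y , ++⁺ xs-inner (anti-mono ys′⊆ (y-inner ∷ ys-inner))

  rainbow-coloring : Σ (Coloring N (suc m)) (RainbowVConnected G)
  rainbow-coloring =
    let c , maximal = grow N initial (ℕₚ.m≤m+n N _)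
    in squash (Core.s≢t c) ,
       connected-dominating⇒rainbow (squash-injective (Core.s≢t c))
         (inner-dominating c maximal) (inner-connected c maximal)

connected⇒rainbow-n∸2 : ∀ {m} (G : Graph (suc (suc (suc m)))) → Connected G →
                        Σ (Coloring (suc (suc (suc m))) (suc m)) (RainbowVConnected G)
connected⇒rainbow-n∸2 G connected = Cores.rainbow-coloring G connected

rvc+rvc≤n∸1 : ∀ n → 5 ≤ n → (G : Graph n) → Connected G → Connected (complement G) →
              ∀ r r′ → IsRVC G r → IsRVC (complement G) r′ → r + r′ ≤ n ∸ 1
rvc+rvc≤n∸1 _ (s≤s (s≤s (s≤s (s≤s (s≤s {n = k} _))))) G connected connectedᶜ r r′ rvc rvcᶜ
  with distance≥3? G | distance≥3? (complement G)
... | yes (_ , _ , far) | yes (_ , _ , farᶜ) =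
  ℕₚ.≤-trans (ℕₚ.+-mono-≤ (IsRVC⇒≤ rvc  (distance≥3⇒rainbow₂ (complement G) G (complement-ᶜ⊆ G) farᶜ))
                          (IsRVC⇒≤ rvcᶜ (distance≥3⇒rainbow₂ G (complement G) (ᶜ⊆-complement G) far)))
             (ℕₚ.m≤m+n 4 k)
... | yes _ | no noneᶜ =
  subst (r + r′ ≤_) (ℕₚ.+-comm (3 + k) 1)
    (ℕₚ.+-mono-≤ (IsRVC⇒≤ rvc  (connected⇒rainbow-n∸2 G connected))
                 (IsRVC⇒≤ rvcᶜ (¬distance≥3⇒rainbow₁ (complement G) noneᶜ)))
... | no none | _ =
  ℕₚ.+-mono-≤ (IsRVC⇒≤ rvc  (¬distance≥3⇒rainbow₁ G none))
              (IsRVC⇒≤ rvcᶜ (connected⇒rainbow-n∸2 (complement G) connectedᶜ))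

∣1+n-n∣≡1 : ∀ n → ∣ suc n - n ∣ ≡ 1
∣1+n-n∣≡1 zero    = refl
∣1+n-n∣≡1 (suc n) = ∣1+n-n∣≡1 n

m+2≤n⇒2≤∣m-n∣ : ∀ {m n} → m + 2 ≤ n → 2 ≤ ∣ m - n ∣
m+2≤n⇒2≤∣m-n∣ {zero}  m+2≤n       = m+2≤n
m+2≤n⇒2≤∣m-n∣ {suc m} (s≤s m+2≤n) = m+2≤n⇒2≤∣m-n∣ m+2≤n

pathGraph : ∀ n → Graph n
pathGraph n = record
  { adj     = λ x y → ∣ toℕ x - toℕ y ∣ ≡ᵇ 1
  ; adj-sym = λ x y → cong (_≡ᵇ 1) (ℕₚ.∣-∣-comm (toℕ x) (toℕ y))
  ; irrefl  = λ x → cong (_≡ᵇ 1) (ℕₚ.∣n-n∣≡0 (toℕ x))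
  }

module PathGraph {n : ℕ} where

  open Routes (pathGraph n)

  edge⇒dist≡1 : ∀ {x y} → Edge (pathGraph n) x y → ∣ toℕ x - toℕ y ∣ ≡ 1
  edge⇒dist≡1 e = ℕₚ.≡ᵇ⇒≡ _ 1 (Equivalence.from Boolₚ.T-≡ e)

  dist≡1⇒edge : ∀ x y → ∣ toℕ x - toℕ y ∣ ≡ 1 → Edge (pathGraph n) x y
  dist≡1⇒edge _ _ d≡1 = Equivalence.to Boolₚ.T-≡ (ℕₚ.≡⇒≡ᵇ _ 1 d≡1)

  edge⇒≤1+ : ∀ {x y} → Edge (pathGraph n) x y → toℕ y ≤ suc (toℕ x)
  edge⇒≤1+ {x} {y} e =
    subst (toℕ y ≤_)
          (trans (cong (toℕ x +_) (edge⇒dist≡1 {y} {x} (edge-sym {x} {y} e))) (ℕₚ.+-comm (toℕ x) 1))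
          (ℕₚ.m≤n+∣m-n∣ (toℕ y) (toℕ x))

  far⇒complement-edge : ∀ x y → 2 ≤ ∣ toℕ x - toℕ y ∣ → Edge (complement (pathGraph n)) x y
  far⇒complement-edge x y 2≤d =
    ᶜ⊆-complement (pathGraph n) x≢y (Boolₚ.¬-not (d≢1 ∘ edge⇒dist≡1 {x} {y}))
    where
    d≢1 : ∣ toℕ x - toℕ y ∣ ≢ 1
    d≢1 d≡1 = ℕₚ.1+n≰n (subst (2 ≤_) d≡1 2≤d)
    x≢y : x ≢ y
    x≢y refl = ℕₚ.1+n≰n (ℕₚ.≤-trans (subst (2 ≤_) (ℕₚ.∣n-n∣≡0 (toℕ x)) 2≤d) z≤n)

  route-crosses : ∀ {u v xs} t → Route u v xs → toℕ u ≤ t → t ≤ toℕ v →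
                  ∃ λ x → x ∈ u ∷ xs × toℕ x ≡ t
  route-crosses t stay u≤t t≤v = _ , here refl , ℕₚ.≤-antisym u≤t t≤v
  route-crosses {u} t (move e r) u≤t t≤v with toℕ u ℕₚ.≟ t
  ... | yes u≡t = u , here refl , u≡t
  ... | no u≢t with route-crosses t r (ℕₚ.≤-trans (edge⇒≤1+ e) (ℕₚ.≤∧≢⇒< u≤t u≢t)) t≤v
  ...   | x , x∈ , x≡t = x , there x∈ , x≡t

path-connected : ∀ n → Connected (pathGraph (suc n))
path-connected n = routes⇒connected λ u v →
  let xs , u⇝0 = route-to-zero (toℕ u) u refl
      ys , v⇝0 = route-to-zero (toℕ v) v refl
      ys′ , 0⇝v , _ = reverseᴿ v⇝0
  in xs ++ ys′ , u⇝0 ++ᴿ 0⇝v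
  where
  open Routes (pathGraph (suc n))
  open PathGraph {suc n}
  route-to-zero : ∀ t (x : Fin (suc n)) → toℕ x ≡ t → ∃ (Route x zero)
  route-to-zero zero x x≡0 with toℕ-injective {i = x} {j = zero} x≡0
  ... | refl = [] , stay
  route-to-zero (suc t) x x≡1+t =
    let t<1+n    = ℕₚ.<-trans (ℕₚ.n<1+n t) (subst (_< suc n) x≡1+t (toℕ<n x))
        y        = fromℕ< t<1+n
        ys , y⇝0 = route-to-zero t y (toℕ-fromℕ< t<1+n)
        x~y      = dist≡1⇒edge x y (trans (cong₂ ∣_-_∣ x≡1+t (toℕ-fromℕ< t<1+n)) (∣1+n-n∣≡1 t))
    in y ∷ ys , move x~y y⇝0

-- Two adjacent vertices of the path are both far from 0, or both within 2 of 0 and far from the last vertex.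
path-complement-diameter≤2 : ∀ k → Routes.Diameter≤2 (complement (pathGraph (5 + k)))
path-complement-diameter≤2 k {a} {b} a≢b nonedge = choose (2 ℕₚ.≤? toℕ a) (2 ℕₚ.≤? toℕ b)
  where
  open PathGraph {5 + k}
  last : Fin (5 + k)
  last = fromℕ (4 + k)
  Common : Set
  Common = ∃ λ x → Edge (complement (pathGraph (5 + k))) a x × Edge (complement (pathGraph (5 + k))) x b
  ∣a-b∣≡1 : ∣ toℕ a - toℕ b ∣ ≡ 1
  ∣a-b∣≡1 = edge⇒dist≡1 {a} {b} (complement-ᶜ⊆ (pathGraph (5 + k)) a≢b nonedge)
  ≤1⇒neighbour≤2 : ∀ {m n} → m ≤ 1 → ∣ m - n ∣ ≡ 1 → n ≤ 2
  ≤1⇒neighbour≤2 {m} {n} m≤1 d≡1 =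
    ℕₚ.≤-trans (subst (n ≤_) (cong (m +_) d≡1) (ℕₚ.m≤n+∣n-m∣ n m)) (ℕₚ.+-monoˡ-≤ 1 m≤1)
  +2≤last : ∀ {m} → m ≤ 2 → m + 2 ≤ toℕ last
  +2≤last {m} m≤2 =
    subst (m + 2 ≤_) (sym (toℕ-fromℕ (4 + k))) (ℕₚ.≤-trans (ℕₚ.+-monoˡ-≤ 2 m≤2) (ℕₚ.m≤m+n 4 k))
  via-last : toℕ a ≤ 2 → toℕ b ≤ 2 → Common
  via-last a≤2 b≤2 =
    last , far⇒complement-edge a last (m+2≤n⇒2≤∣m-n∣ (+2≤last a≤2)) ,
    far⇒complement-edge last b (subst (2 ≤_) (ℕₚ.∣-∣-comm (toℕ b) _) (m+2≤n⇒2≤∣m-n∣ (+2≤last b≤2)))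
  choose : Dec (2 ≤ toℕ a) → Dec (2 ≤ toℕ b) → Common
  choose (yes 2≤a) (yes 2≤b) =
    zero , far⇒complement-edge a zero (subst (2 ≤_) (sym (ℕₚ.∣-∣-identityʳ (toℕ a))) 2≤a) ,
    far⇒complement-edge zero b 2≤b
  choose (no a≱2) _ =
    let a≤1 = ℕₚ.≤-pred (ℕₚ.≰⇒> a≱2)
    in via-last (ℕₚ.≤-trans a≤1 (ℕₚ.n≤1+n 1)) (≤1⇒neighbour≤2 a≤1 ∣a-b∣≡1)
  choose (yes _) (no b≱2) =
    let b≤1 = ℕₚ.≤-pred (ℕₚ.≰⇒> b≱2)
    in via-last (≤1⇒neighbour≤2 b≤1 (trans (ℕₚ.∣-∣-comm (toℕ b) (toℕ a)) ∣a-b∣≡1))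
                (ℕₚ.≤-trans b≤1 (ℕₚ.n≤1+n 1))

∈-inner : ∀ {A : Set} {x u v : A} ws → x ∈ u ∷ ws ++ [ v ] → x ≢ u → x ≢ v → x ∈ ws
∈-inner ws (here x≡u) x≢u _ = ⊥-elim (x≢u x≡u)
∈-inner ws (there x∈) _ x≢v with ∈-++⁻ ws x∈
... | inj₁ x∈ws         = x∈ws
... | inj₂ (here x≡v) = ⊥-elim (x≢v x≡v)

-- Every path between the two ends of the path graph passes through all n ∸ 2 inner vertices.
path-rvc : ∀ k → IsRVC (pathGraph (5 + k)) (3 + k)
path-rvc k = connected⇒rainbow-n∸2 P (path-connected (4 + k)) ,
             λ j j<3+k coloring →
               ℕₚ.<⇒≱ j<3+k (cut⇒colors≥ P (λ ()) inner inner-injective through coloring)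
  where
  open Routes (pathGraph (5 + k))
  open PathGraph {5 + k}
  P : Graph (5 + k)
  P = pathGraph (5 + k)
  last : Fin (5 + k)
  last = fromℕ (4 + k)
  inner : Fin (3 + k) → Fin (5 + k)
  inner i = suc (inject₁ i)
  inner-injective : Injective _≡_ _≡_ inner
  inner-injective = inject₁-injective ∘ Finₚ.suc-injective
  through : ∀ {ws} → IsPath P zero ws last → ∀ i → inner i ∈ ws
  through {ws} (walk , _) i =
    let x , x∈ , x≡i = route-crosses (toℕ (inner i)) (walk⇒route ws walk) z≤n
                         (subst (toℕ (inner i) ≤_) (sym (toℕ-fromℕ (4 + k))) (toℕ<n (inject₁ i)))
    in ∈-inner ws (subst (_∈ _) (toℕ-injective x≡i) x∈) (λ ())
         (λ i≡last → toℕ-inject₁-≢ i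
                       (sym (ℕₚ.suc-injective (trans (cong toℕ i≡last) (toℕ-fromℕ (4 + k))))))

path-complement-rvc : ∀ k → IsRVC (complement (pathGraph (5 + k))) 1
path-complement-rvc k =
  ((λ _ → zero) , diameter≤2⇒rainbow (path-complement-diameter≤2 k) _) ,
  λ { zero _ (c , _) → no-color (c zero) ; (suc _) (s≤s ()) _ }
  where
  open Routes (complement (pathGraph (5 + k)))
  no-color : Fin 0 → ⊥
  no-color ()

pathGraph-attains : ∀ n → 5 ≤ n → Σ (Graph n) λ G → Connected G × Connected (complement G) ×
                    Σ ℕ λ r → Σ ℕ λ r′ → IsRVC G r × IsRVC (complement G) r′ × r + r′ ≡ n ∸ 1
pathGraph-attains _ (s≤s (s≤s (s≤s (s≤s (s≤s {n = k} _))))) =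
  pathGraph (5 + k) , path-connected (4 + k) , rainbow⇒connected (proj₂ (proj₁ (path-complement-rvc k))) ,
  3 + k , 1 , path-rvc k , path-complement-rvc k , ℕₚ.+-comm (3 + k) 1

theorem2p3 : (∀ (n : ℕ) → 5 ≤ n → (G : Graph n) → Connected G → Connected (complement G) →
    ∀ (r r' : ℕ) → IsRVC G r → IsRVC (complement G) r' → r + r' ≤ n ∸ 1)
    ×
    (∀ (n : ℕ) → 5 ≤ n → Σ (Graph n) λ G → (Connected G × Connected (complement G) ×
    Σ ℕ λ r → Σ ℕ λ r' → (IsRVC G r × IsRVC (complement G) r' × r + r' ≡ n ∸ 1)))
theorem2p3 = rvc+rvc≤n∸1 , pathGraph-attains
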